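{- Let $G=(X,Y,E)$ be a connected chain graph with $|X|\ge 4$ and $|Y|\ge 4$. Then $\gamma_{cs}(G)\ge 4$.
   Context: All graphs are finite, simple, undirected, without isolated vertices. A set $S$ of vertices is a cosecure dominating set if every vertex outside $S$ has a neighbour in $S$ and for every $u\in S$ there is a neighbour $v\notin S$ of $u$ such that $(S\setminus\{u\})\cup\{v\}$ is still dominating; $\gamma_{cs}(G)$ is the minimum size of a cosecure dominating set. A bipartite graph $G=(X,Y,E)$ is a chain graph if $X$ can be ordered $x_1,\dots,x_{n_1}$ with $N(x_1)\subseteq N(x_2)\subseteq\cdots\subseteq N(x_{n_1})$. -}

module Defs where

open import Data.Nat using (ℕ; _+_; _≥_)
open import Data.Fin using (Fin; _≤_) renaming (_≟_ to _≟ᶠ_)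
open import Data.Fin.Permutation using (Permutation′; _⟨$⟩ʳ_)
open import Data.Fin.Subset using (∣_∣)
open import Data.Vec using (tabulate)
open import Data.Bool using (Bool; true; false; if_then_else_)
open import Data.Sum using (_⊎_; inj₁; inj₂)
open import Data.Sum.Properties using (≡-dec)
open import Data.Empty using (⊥)
open import Data.Product using (Σ; _×_; ∃; ∃-syntax)
open import Relation.Nullary using (does)
open import Relation.Binary.PropositionalEquality using (_≡_)
open import Relation.Binary.Construct.Closure.ReflexiveTransitive using (Star)

-- A bipartite graph G = (X, Y, E) with X = Fin n₁, Y = Fin n₂ and
-- edge relation given by a Boolean matrix E x y (edges only between X and Y).
-- Such a graph is automatically finite, simple and undirected.
BipEdges : ℕ → ℕ → Set
BipEdges n₁ n₂ = Fin n₁ → Fin n₂ → Bool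

V : ℕ → ℕ → Set
V n₁ n₂ = Fin n₁ ⊎ Fin n₂

_≟V_ : ∀ {n₁ n₂} → (u v : V n₁ n₂) → _
_≟V_ = ≡-dec _≟ᶠ_ _≟ᶠ_

Adj : ∀ {n₁ n₂} → BipEdges n₁ n₂ → V n₁ n₂ → V n₁ n₂ → Set
Adj E (inj₁ x) (inj₁ x′) = ⊥
Adj E (inj₁ x) (inj₂ y)  = E x y ≡ true
Adj E (inj₂ y) (inj₁ x)  = E x y ≡ true
Adj E (inj₂ y) (inj₂ y′) = ⊥

NoIsolated : ∀ {n₁ n₂} → BipEdges n₁ n₂ → Set
NoIsolated E = ∀ u → ∃[ v ] Adj E u v

Connected : ∀ {n₁ n₂} → BipEdges n₁ n₂ → Set
Connected E = ∀ u v → Star (Adj E) u v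

-- chain graph: X can be ordered x_1,...,x_{n₁} (via a permutation σ of Fin n₁,
-- x_i = σ i) with N(x_1) ⊆ N(x_2) ⊆ ... ⊆ N(x_{n₁})
IsChain : ∀ {n₁ n₂} → BipEdges n₁ n₂ → Set
IsChain {n₁} {n₂} E =
  Σ (Permutation′ n₁) λ σ →
    ∀ (i j : Fin n₁) → i ≤ j → ∀ (y : Fin n₂) →
      E (σ ⟨$⟩ʳ i) y ≡ true → E (σ ⟨$⟩ʳ j) y ≡ true

VSet : ℕ → ℕ → Set
VSet n₁ n₂ = V n₁ n₂ → Bool

size : ∀ {n₁ n₂} → VSet n₁ n₂ → ℕ
size S = ∣ tabulate (λ x → S (inj₁ x)) ∣ + ∣ tabulate (λ y → S (inj₂ y)) ∣

Dominating : ∀ {n₁ n₂} → BipEdges n₁ n₂ → VSet n₁ n₂ → Set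
Dominating E S = ∀ v → S v ≡ false → ∃[ u ] (Adj E v u × S u ≡ true)

swap : ∀ {n₁ n₂} → VSet n₁ n₂ → V n₁ n₂ → V n₁ n₂ → VSet n₁ n₂
swap S u v w =
  if does (w ≟V u) then false else (if does (w ≟V v) then true else S w)

CosecureDominating : ∀ {n₁ n₂} → BipEdges n₁ n₂ → VSet n₁ n₂ → Set
CosecureDominating E S =
  Dominating E S ×
  (∀ u → S u ≡ true →
    ∃[ v ] (Adj E u v × S v ≡ false × Dominating E (swap S u v)))

γcs≥ : ∀ {n₁ n₂} → BipEdges n₁ n₂ → ℕ → Set
γcs≥ E k = ∀ S → CosecureDominating E S → size S ≥ k

-- If a cosecure dominating set S meets Y in at most one vertex y,
-- then S must contain every x ∈ X (when S ∩ Y = ∅), or, after the secure swap of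
-- y for a neighbour x′, the resulting dominating set avoids Y entirely, so S
-- contains every x ≠ x′; either way |S| ≥ |X|.  By symmetry the same holds with
-- X and Y exchanged, and otherwise S meets both sides twice.
module Submission where

open import Defs
open import Data.Nat using (ℕ; _≤_; _<_; _≥_; _+_; _∸_; _≤?_; s≤s; z≤n)
open import Data.Nat.Properties
  using (≤-trans; ≤-pred; module ≤-Reasoning; ≰⇒>; +-mono-≤; +-comm; m≤m+n; m∸n+n≡m)
open import Data.Fin using (Fin) renaming (_≟_ to _≟ᶠ_)
open import Data.Fin.Properties using (toℕ<n)
open import Data.Fin.Subset using (Subset; _∈_; _⊆_; ⊤; ∁; ⁅_⁆; _-_; ∣_∣; Empty)
open import Data.Fin.Subset.Properties
  using (x∈p∧x≢y⇒x∈p-y; x∈p⇒∣p-x∣<∣p∣; p⊆q⇒∣p∣≤∣q∣; ∣⁅x⁆∣≡1; x∈⁅y⁆⇒x≡y; x∈⁅x⁆;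
         ∣⊤∣≡n; ∣∁p∣≡n∸∣p∣; ∈⊤; x∈∁p⇒x∉p; nonempty?)
open import Data.Vec using (tabulate)
open import Data.Vec.Properties using (lookup∘tabulate; lookup⇒[]=; []=⇒lookup)
open import Data.Bool using (Bool; true; false)
open import Data.Sum using (_⊎_; inj₁; inj₂)
import Data.Sum as Sum
open import Data.Sum.Properties using (inj₁-injective; swap-involutive)
open import Data.Product using (_×_; _,_; ∃-syntax)
open import Function using (_∘_)
open import Relation.Nullary using (yes; no; contradiction)
open import Relation.Binary.PropositionalEquality
  using (_≡_; _≢_; refl; sym; trans; cong; subst; _≗_)

private
  variable
    n n₁ n₂ : ℕ

∈-tabulate⁺ : ∀ {f : Fin n → Bool} {i} → f i ≡ true → i ∈ tabulate f
∈-tabulate⁺ {f = f} {i} fi = lookup⇒[]= i (tabulate f) (trans (lookup∘tabulate f i) fi)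

∈-tabulate⁻ : ∀ {f : Fin n → Bool} {i} → i ∈ tabulate f → f i ≡ true
∈-tabulate⁻ {f = f} {i} i∈ = trans (sym (lookup∘tabulate f i)) ([]=⇒lookup i∈)

x∈p⇒0<∣p∣ : ∀ {p : Subset n} {x} → x ∈ p → 0 < ∣ p ∣
x∈p⇒0<∣p∣ {x = x} x∈p =
  subst (_≤ _) (∣⁅x⁆∣≡1 x) (p⊆q⇒∣p∣≤∣q∣ (λ y∈⁅x⁆ → subst (_∈ _) (sym (x∈⁅y⁆⇒x≡y x y∈⁅x⁆)) x∈p))

∣p∣≤1⇒∈-unique : ∀ {p : Subset n} {x y} → ∣ p ∣ ≤ 1 → x ∈ p → y ∈ p → y ≡ x
∣p∣≤1⇒∈-unique {x = x} {y} ∣p∣≤1 x∈p y∈p with y ≟ᶠ x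
... | yes y≡x = y≡x
... | no y≢x  = contradiction
  (≤-trans (x∈p⇒0<∣p∣ (x∈p∧x≢y⇒x∈p-y y∈p y≢x)) (≤-pred (≤-trans (x∈p⇒∣p-x∣<∣p∣ x∈p) ∣p∣≤1)))
  λ ()

Xpart : VSet n₁ n₂ → Subset n₁
Xpart S = tabulate (S ∘ inj₁)

Ypart : VSet n₁ n₂ → Subset n₂
Ypart S = tabulate (S ∘ inj₂)

swap≡true⁻ : ∀ (S : VSet n₁ n₂) u v w → swap S u v w ≡ true → w ≢ u × (w ≡ v ⊎ S w ≡ true)
swap≡true⁻ S u v w sw with w ≟V u | w ≟V v
... | no w≢u | yes w≡v = w≢u , inj₁ w≡v
... | no w≢u | no _    = w≢u , inj₂ sw

Dominating-resp-≗ : ∀ {E : BipEdges n₁ n₂} {S T} → S ≗ T → Dominating E S → Dominating E T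
Dominating-resp-≗ S≗T dom v Tv with dom v (trans (S≗T v) Tv)
... | u , adj , Su = u , adj , trans (sym (S≗T u)) Su

⊤⊆Xpart-if-Empty-Ypart : ∀ {E : BipEdges n₁ n₂} {S} → Dominating E S → Empty (Ypart S) → ⊤ ⊆ Xpart S
⊤⊆Xpart-if-Empty-Ypart {S = S} dom noY {x} _ with S (inj₁ x) in Sx
... | true = ∈-tabulate⁺ Sx
... | false with dom (inj₁ x) Sx
...   | inj₂ y , _ , Sy = contradiction (y , ∈-tabulate⁺ Sy) noY

Empty-Ypart-after-swapping-out-Y : ∀ {S : VSet n₁ n₂} {y x′} → ∣ Ypart S ∣ ≤ 1 → y ∈ Ypart S →
  Empty (Ypart (swap S (inj₂ y) (inj₁ x′)))
Empty-Ypart-after-swapping-out-Y {S = S} {y} {x′} ∣Y∣≤1 y∈Y (y″ , y″∈)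
  with swap≡true⁻ S (inj₂ y) (inj₁ x′) (inj₂ y″) (∈-tabulate⁻ y″∈)
... | y″≢y , inj₂ Sy″ = y″≢y (cong inj₂ (∣p∣≤1⇒∈-unique ∣Y∣≤1 y∈Y (∈-tabulate⁺ Sy″)))

∁⁅x′⁆⊆Xpart-after-swapping-out-Y : ∀ {E : BipEdges n₁ n₂} {S} {y x′} →
  ∣ Ypart S ∣ ≤ 1 → y ∈ Ypart S →
  Dominating E (swap S (inj₂ y) (inj₁ x′)) → ∁ ⁅ x′ ⁆ ⊆ Xpart S
∁⁅x′⁆⊆Xpart-after-swapping-out-Y {S = S} {y} {x′} ∣Y∣≤1 y∈Y dom′ {x} x∈∁⁅x′⁆
  with swap≡true⁻ S (inj₂ y) (inj₁ x′) (inj₁ x)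
         (∈-tabulate⁻ (⊤⊆Xpart-if-Empty-Ypart dom′
                         (Empty-Ypart-after-swapping-out-Y {S = S} {x′ = x′} ∣Y∣≤1 y∈Y) ∈⊤))
... | _ , inj₁ x≡x′ =
  contradiction (subst (_∈ ⁅ x′ ⁆) (sym (inj₁-injective x≡x′)) (x∈⁅x⁆ x′)) (x∈∁p⇒x∉p x∈∁⁅x′⁆)
... | _ , inj₂ Sx   = ∈-tabulate⁺ Sx

n₁≤size-if-∣Ypart∣≤1 : ∀ {E : BipEdges n₁ n₂} {S} → CosecureDominating E S → ∣ Ypart S ∣ ≤ 1 → n₁ ≤ size S
n₁≤size-if-∣Ypart∣≤1 {n₁ = n₁} {S = S} (dom , secure) ∣Y∣≤1 with nonempty? (Ypart S)
... | no noY = begin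
  n₁                        ≡⟨ sym (∣⊤∣≡n n₁) ⟩
  ∣ ⊤ {n₁} ∣                ≤⟨ p⊆q⇒∣p∣≤∣q∣ (⊤⊆Xpart-if-Empty-Ypart dom noY) ⟩
  ∣ Xpart S ∣               ≤⟨ m≤m+n _ _ ⟩
  ∣ Xpart S ∣ + ∣ Ypart S ∣ ∎
  where open ≤-Reasoning
... | yes (y , y∈Y) with secure (inj₂ y) (∈-tabulate⁻ y∈Y)
...   | inj₁ x′ , _ , _ , dom′ = begin
  n₁                        ≡⟨ sym (m∸n+n≡m (≤-trans (s≤s z≤n) (toℕ<n x′))) ⟩
  n₁ ∸ 1 + 1                ≡⟨ cong (λ k → n₁ ∸ k + 1) (sym (∣⁅x⁆∣≡1 x′)) ⟩
  n₁ ∸ ∣ ⁅ x′ ⁆ ∣ + 1       ≡⟨ cong (_+ 1) (sym (∣∁p∣≡n∸∣p∣ ⁅ x′ ⁆)) ⟩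
  ∣ ∁ ⁅ x′ ⁆ ∣ + 1          ≤⟨ +-mono-≤ (p⊆q⇒∣p∣≤∣q∣ (∁⁅x′⁆⊆Xpart-after-swapping-out-Y ∣Y∣≤1 y∈Y dom′))
                                         (x∈p⇒0<∣p∣ y∈Y) ⟩
  ∣ Xpart S ∣ + ∣ Ypart S ∣ ∎
  where open ≤-Reasoning

transpose : BipEdges n₁ n₂ → BipEdges n₂ n₁
transpose E y x = E x y

Adj-transpose : ∀ {E : BipEdges n₁ n₂} u v → Adj E (Sum.swap u) v → Adj (transpose E) u (Sum.swap v)
Adj-transpose (inj₁ _) (inj₁ _) adj = adj
Adj-transpose (inj₂ _) (inj₂ _) adj = adj

swap-transpose : ∀ (S : VSet n₁ n₂) u v →
  swap S (Sum.swap u) v ∘ Sum.swap ≗ swap (S ∘ Sum.swap) u (Sum.swap v)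
swap-transpose S (inj₁ _) (inj₁ _) (inj₁ _) = refl
swap-transpose S (inj₁ _) (inj₁ _) (inj₂ _) = refl
swap-transpose S (inj₁ _) (inj₂ _) (inj₁ _) = refl
swap-transpose S (inj₁ _) (inj₂ _) (inj₂ _) = refl
swap-transpose S (inj₂ _) (inj₁ _) (inj₁ _) = refl
swap-transpose S (inj₂ _) (inj₁ _) (inj₂ _) = refl
swap-transpose S (inj₂ _) (inj₂ _) (inj₁ _) = refl
swap-transpose S (inj₂ _) (inj₂ _) (inj₂ _) = refl

Dominating-transpose : ∀ {E : BipEdges n₁ n₂} {S} → Dominating E S → Dominating (transpose E) (S ∘ Sum.swap)
Dominating-transpose {S = S} dom w Sw with dom (Sum.swap w) Sw
... | u , adj , Su = Sum.swap u , Adj-transpose w u adj , trans (cong S (swap-involutive u)) Su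

CosecureDominating-transpose : ∀ {E : BipEdges n₁ n₂} {S} →
  CosecureDominating E S → CosecureDominating (transpose E) (S ∘ Sum.swap)
CosecureDominating-transpose {E = E} {S} (dom , secure) = Dominating-transpose dom , secure′
  where
  secure′ : ∀ u → S (Sum.swap u) ≡ true →
    ∃[ v ] (Adj (transpose E) u v × S (Sum.swap v) ≡ false ×
            Dominating (transpose E) (swap (S ∘ Sum.swap) u v))
  secure′ u Su with secure (Sum.swap u) Su
  ... | v , adj , Sv , dom′ =
    Sum.swap v , Adj-transpose u v adj , trans (cong S (swap-involutive v)) Sv ,
    Dominating-resp-≗ (swap-transpose S u v) (Dominating-transpose dom′)

n₂≤size-if-∣Xpart∣≤1 : ∀ {E : BipEdges n₁ n₂} {S} → CosecureDominating E S → ∣ Xpart S ∣ ≤ 1 → n₂ ≤ size S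
n₂≤size-if-∣Xpart∣≤1 {n₂ = n₂} {S = S} cds ∣X∣≤1 =
  subst (n₂ ≤_) (+-comm ∣ Ypart S ∣ ∣ Xpart S ∣)
    (n₁≤size-if-∣Ypart∣≤1 (CosecureDominating-transpose cds) ∣X∣≤1)

mainTheorem14 : ∀ (n₁ n₂ : ℕ) (E : BipEdges n₁ n₂) → NoIsolated E → IsChain E → Connected E → n₁ ≥ 4 → n₂ ≥ 4 → γcs≥ E 4
mainTheorem14 n₁ n₂ E _ _ _ n₁≥4 n₂≥4 S cds with ∣ Ypart S ∣ ≤? 1 | ∣ Xpart S ∣ ≤? 1
... | yes ∣Y∣≤1 | _         = ≤-trans n₁≥4 (n₁≤size-if-∣Ypart∣≤1 cds ∣Y∣≤1)
... | no _      | yes ∣X∣≤1 = ≤-trans n₂≥4 (n₂≤size-if-∣Xpart∣≤1 cds ∣X∣≤1)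
... | no ∣Y∣≰1  | no ∣X∣≰1  = +-mono-≤ (≰⇒> ∣X∣≰1) (≰⇒> ∣Y∣≰1)
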